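{- Let $(U,\rho)$ be a finite metric space and $T$ a 2-HST of $U$ (as in the context). Let $C_1$ and $C_0$ be the subtree roots and the initial centers produced by the NDP-HST initialization. Then $$\mathrm{cost}^{T}_k(U)\le 2\,\mathrm{cost}'^T_k(U).$$
   Context: $(U,\rho)$ is a finite metric space with $|U|=n$, minimum interpoint distance $1$ and diameter $\Delta$; $L=\log_2\Delta$ is assumed to be an integer. A 2-HST of $U$ is a rooted tree $T$ whose nodes are subsets (clusters) of $U$, obtained by recursive padded decompositions: the root has level $L$; the children of a node at level $i$ are at level $i-1$ and partition its cluster into pieces of diameter at most $\Delta/2^{L-i+1}$; the leaves are in one-to-one correspondence with the points of $U$. $h_v$ denotes the level of node $v$, $T(v)$ the subtree rooted at $v$. The tree metric $\rho^T(x,y)$ is the weighted path distance between the leaves of $x$ and $y$, where an edge joining a node at level $i$ to its child at level $i-1$ has weight $2^{i-1}$. NDP-HST initialization: for every node $v$ let $N_v=|U\cap T(v)|$ and $\mathrm{score}(v)=N_v\cdot 2^{h_v}$. Subtree search: start with $C_1=\emptyset$; while $|C_1|<k$, add to $C_1$ the $k-|C_1|$ highest-score nodes (never re-selecting nodes in $C_1$ or their ancestors), then remove from $C_1$ every node having a descendant in $C_1$; the final $C_1$ consists of $k$ nodes with pairwise disjoint subtrees. Leaf search: for each $v\in C_1$, repeatedly replace $v$ by its child $w$ with largest $N_w$ until a leaf is reached; $C_0$ is the set of the $k$ resulting leaf points. Costs: $\mathrm{cost}^T_k(U)=\sum_{y\in U}\min_{x\in C_0}\rho^T(x,y)$; $\mathrm{cost}'^T_k(U)=\min\{\sum_{y\in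 U}\min_{x\in F}\rho^T(x,y): F\subseteq U,\ |F\cap T(v)|=1\ \forall v\in C_1\}$.
   Formalization: The metric ρ of the finite metric space U takes only rational values. -}

module Defs where

open import Data.Nat using (ℕ; zero; suc; _+_; _*_; _∸_; _^_; _≤_; _<_; _⊓_)
open import Data.Fin using (Fin)
import Data.Fin as Fin
open import Data.Integer using (+_)
open import Data.Rational using (ℚ; _/_; 0ℚ; 1ℚ)
import Data.Rational as ℚ
open import Data.List using (List; []; _∷_; _++_; [_]; length; map; drop; upTo; filter)
open import Data.Nat.ListAction using (sum)
open import Data.List.Membership.Propositional using (_∈_; _∉_)
import Data.List.Membership.DecPropositional as DecMem
open import Data.List.Relation.Unary.Unique.Propositional using (Unique)
open import Data.List.Relation.Binary.Permutation.Propositional using (_↭_)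
open import Data.Maybe using (Maybe; just; nothing; _>>=_; maybe)
open import Data.Product using (Σ; ∃; ∃-syntax; _×_; _,_)
open import Data.Bool using (if_then_else_)
open import Relation.Binary.PropositionalEquality using (_≡_; _≢_)
open import Relation.Nullary using (¬_; does)
open import Function.Bundles using (_⇔_)

record IsMetric {n : ℕ} (ρ : Fin n → Fin n → ℚ) : Set where
  field
    zero-iff : ∀ x y → (ρ x y ≡ 0ℚ) ⇔ (x ≡ y)
    nonneg   : ∀ x y → 0ℚ ℚ.≤ ρ x y
    sym      : ∀ x y → ρ x y ≡ ρ y x
    triangle : ∀ x y z → ρ x z ℚ.≤ ρ x y ℚ.+ ρ y z

pow2ℚ : ℕ → ℚ
pow2ℚ j = + (2 ^ j) / 1

record MetricSpaceData (n L : ℕ) (ρ : Fin n → Fin n → ℚ) : Set where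
  field
    metric   : IsMetric ρ
    minDist  : ∀ x y → x ≢ y → 1ℚ ℚ.≤ ρ x y
    diamUB   : ∀ x y → ρ x y ℚ.≤ pow2ℚ L
    diamAttn : ∃[ x ] ∃[ y ] (ρ x y ≡ pow2ℚ L)

-- Rooted trees; a node is identified by its path (list of child indices)
-- from the root.  The level of the node at path p is L ∸ length p.

data Tree (A : Set) : Set where
  leaf : A → Tree A
  node : List (Tree A) → Tree A

Path : Set
Path = List ℕ

nth : {A : Set} → List A → ℕ → Maybe A
nth []       _       = nothing
nth (x ∷ xs) zero    = just x
nth (x ∷ xs) (suc i) = nth xs i

sub : {A : Set} → Tree A → Path → Maybe (Tree A)
sub t          []      = just t
sub (leaf _)   (_ ∷ _) = nothing
sub (node ts)  (i ∷ p) = nth ts i >>= λ t → sub t p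

mutual
  leaves : {A : Set} → Tree A → List A
  leaves (leaf x)  = x ∷ []
  leaves (node ts) = leavesL ts

  leavesL : {A : Set} → List (Tree A) → List A
  leavesL []       = []
  leavesL (t ∷ ts) = leaves t ++ leavesL ts

mutual
  locate : {n : ℕ} → Tree (Fin n) → Fin n → Maybe Path
  locate (leaf y)  x = if does (x Fin.≟ y) then just [] else nothing
  locate (node ts) x = locateL 0 ts x

  locateL : {n : ℕ} → ℕ → List (Tree (Fin n)) → Fin n → Maybe Path
  locateL i []       x = nothing
  locateL i (t ∷ ts) x with locate t x
  ... | just p  = just (i ∷ p)
  ... | nothing = locateL (suc i) ts x

_⊏_ : Path → Path → Set
p ⊏ q = Σ ℕ λ i → Σ Path λ r → q ≡ p ++ (i ∷ r)

lcp : Path → Path → ℕ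
lcp (i ∷ p) (j ∷ q) with does (i Data.Nat.≟ j)
... | Data.Bool.true  = suc (lcp p q)
... | Data.Bool.false = zero
lcp _ _ = zero

-- minimum of a list of naturals (0 for the empty list; only used on nonempty lists)
minL : List ℕ → ℕ
minL []           = 0
minL (x ∷ [])     = x
minL (x ∷ y ∷ xs) = x ⊓ minL (y ∷ xs)

record Is2HST (n L : ℕ) (ρ : Fin n → Fin n → ℚ) (T : Tree (Fin n)) : Set where
  field
    leaves-bij   : leaves T ↭ Data.List.allFin n
    leaf-level   : ∀ p x → sub T p ≡ just (leaf x) → length p ≡ L
    node-level   : ∀ p ts → sub T p ≡ just (node ts) → length p < L × ts ≢ []
    -- a node at level j has a cluster of diameter ≤ 2^j = Δ / 2^(L-j)
    cluster-diam : ∀ p t → sub T p ≡ just t → ∀ x y → x ∈ leaves t → y ∈ leaves t →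
                   ρ x y ℚ.≤ pow2ℚ (L ∸ length p)

module HST (n L k : ℕ) (T : Tree (Fin n)) where

  IsNode : Path → Set
  IsNode p = ∃[ t ] (sub T p ≡ just t)

  level : Path → ℕ
  level p = L ∸ length p

  cluster : Path → List (Fin n)
  cluster p = maybe leaves [] (sub T p)

  N : Path → ℕ
  N p = length (cluster p)

  score : Path → ℕ
  score p = N p * 2 ^ level p

  -- weight of the edge joining depth e (level L ∸ e) to depth e + 1: 2^(L ∸ e ∸ 1)
  edgeW : ℕ → ℕ
  edgeW e = 2 ^ (L ∸ suc e)

  chainW : ℕ → ℕ → ℕ
  chainW d D = sum (map edgeW (drop d (upTo D)))

  pathDist : Path → Path → ℕ
  pathDist p q = chainW (lcp p q) (length p) + chainW (lcp p q) (length q)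

  distM : Maybe Path → Maybe Path → ℕ
  distM (just p) (just q) = pathDist p q
  distM _        _        = 0

  ρT : Fin n → Fin n → ℕ
  ρT x y = distM (locate T x) (locate T y)

  costF : List (Fin n) → ℕ
  costF F = sum (map (λ y → minL (map (λ x → ρT x y) F)) (Data.List.allFin n))

  Eligible : List Path → Path → Set
  Eligible C u = IsNode u × u ∉ C × (∀ c → c ∈ C → ¬ (u ⊏ c))

  -- one iteration of the while loop, with arbitrary tie-breaking
  record Step (C C' : List Path) : Set where
    field
      S          : List Path
      S-size     : length S ≡ k ∸ length C
      S-unique   : Unique S
      S-eligible : ∀ s → s ∈ S → Eligible C s
      S-highest  : ∀ u s → Eligible C u → u ∉ S → s ∈ S → score u ≤ score s
      C'-unique  : Unique C'
      C'-members : ∀ v → (v ∈ C') ⇔ ((v ∈ C ++ S) × (∀ w → w ∈ C ++ S → ¬ (v ⊏ w)))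

  data Run : List Path → List Path → Set where
    done : ∀ {C} → k ≤ length C → Run C C
    step : ∀ {C C' D} → length C < k → Step C C' → Run C' D → Run C D

  data Descend : Path → Path → Set where
    stop : ∀ {p x} → sub T p ≡ just (leaf x) → Descend p p
    go   : ∀ {p i q} → IsNode (p ++ [ i ]) →
           (∀ j → IsNode (p ++ [ j ]) → N (p ++ [ j ]) ≤ N (p ++ [ i ])) →
           Descend (p ++ [ i ]) q → Descend p q

  LeafSearch : Path → Fin n → Set
  LeafSearch v x = Σ Path λ q → Descend v q × sub T q ≡ just (leaf x)

  Feasible : List Path → List (Fin n) → Set
  Feasible C₁ F = Unique F × length F ≡ k ×
                  (∀ v → v ∈ C₁ → length (filter (λ x → DecMem._∈?_ (Fin._≟_ {n}) x (cluster v)) F) ≡ 1)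

  IsCost' : List Path → ℕ → Set
  IsCost' C₁ c = (∃[ F ] (Feasible C₁ F × costF F ≡ c)) ×
                 (∀ F → Feasible C₁ F → c ≤ costF F)

module Submission where

-- Fix a feasible F, a root v ∈ C₁, the leaf x reached from v by leaf search and the point f of F
-- in T(v).  The tree distance ρᵀ(x, y) depends only on the depth of the lowest common ancestor of
-- x and y and decreases with it.  Induct along the leaf search from v: at a node p, if f lies in the
-- heaviest child chosen by the search, the points of T(p) outside that child are as far from x as
-- from f; otherwise f lies in a lighter sibling, so at least half of T(p) lies outside f's child,
-- each such point at least as far from f as x is from any point of T(p).  Hence
-- Σ_{y ∈ T(v)} ρᵀ(x, y) ≤ 2 Σ_{y ∈ T(v)} ρᵀ(f, y), and f is the point of F nearest to each y ∈ T(v).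
-- A point outside every T(v) is as far from the centre of each T(v) as from the point of F in it,
-- and every point of F lies in some T(v).

open import Defs
open import Data.Nat using (ℕ; zero; suc; _+_; _*_; _∸_; _≤_; _<_; z≤n; s≤s; _≡ᵇ_; _≟_)
open import Data.Nat.Properties
open import Algebra.Properties.CommutativeSemigroup +-commutativeSemigroup using (interchange)
open import Data.Nat.ListAction using (sum)
open import Data.Maybe using (just; nothing; _>>=_)
open import Data.Fin using (Fin)
import Data.Fin as Fin
open import Data.Rational using (ℚ)
open import Data.Bool using (Bool; true; false; _∧_; not)
open import Data.List using (List; []; _∷_; _++_; [_]; length; map; filter; drop; upTo; allFin)
open import Data.List.Properties
  using (++-assoc; ++-identityʳ; ++-cancelˡ; ∷-injective; length-++; length-map; map-∘; drop-drop; drop-all; length-upTo)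
open import Data.List.Membership.Propositional using (_∈_; _∉_)
open import Data.List.Membership.Propositional.Properties using (∈-map⁺; ∈-++⁺ˡ; ∈-++⁺ʳ; ∈-++⁻; ∈-allFin)
import Data.List.Membership.DecPropositional as DecMembership
open import Data.List.Relation.Unary.All as All using (All)
import Data.List.Relation.Unary.All.Properties as All
open import Data.List.Relation.Unary.AllPairs using ([]; _∷_)
open import Data.List.Relation.Unary.Any using (here; there)
open import Data.List.Relation.Unary.Unique.Propositional using (Unique)
open import Data.List.Relation.Unary.Unique.Propositional.Properties using (allFin⁺)
open import Data.List.Relation.Binary.Permutation.Propositional using (↭-sym; ↭⇒↭ₛ)
open import Data.List.Relation.Binary.Permutation.Propositional.Properties using (∈-resp-↭)
import Data.List.Relation.Binary.Permutation.Setoid.Properties as Permutationₛ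
open import Data.List.Relation.Binary.Pointwise using (Pointwise; []; _∷_)
open import Data.Product using (∃-syntax; _×_; _,_; proj₁; proj₂; uncurry)
open import Data.Empty using (⊥-elim)
open import Data.Sum using (_⊎_; inj₁; inj₂)
open import Function using (_∘_)
open import Function.Bundles using (Equivalence)
open import Relation.Nullary using (¬_; Dec; yes; no; does; proof; contradiction)
open import Relation.Nullary.Reflects using (Reflects; ofʸ; ofⁿ)
open import Relation.Binary.PropositionalEquality hiding ([_])
open import Relation.Binary.PropositionalEquality.Properties using (setoid)

private variable
  A B : Set

𝟙 : Bool → ℕ
𝟙 true  = 1
𝟙 false = 0

m*n+[1∸m]*n≡n : ∀ {m} n → m ≤ 1 → m * n + (1 ∸ m) * n ≡ n
m*n+[1∸m]*n≡n {m} n m≤1 =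
  trans (sym (*-distribʳ-+ n m (1 ∸ m))) (trans (cong (_* n) (m+[n∸m]≡n m≤1)) (*-identityˡ n))

sum-map-+ : (f g : A → ℕ) (xs : List A) →
            sum (map (λ x → f x + g x) xs) ≡ sum (map f xs) + sum (map g xs)
sum-map-+ f g []       = refl
sum-map-+ f g (x ∷ xs) =
  trans (cong (f x + g x +_) (sum-map-+ f g xs)) (interchange (f x) (g x) _ _)

sum-map-*ˡ : (m : ℕ) (f : A → ℕ) (xs : List A) →
             sum (map (λ x → m * f x) xs) ≡ m * sum (map f xs)
sum-map-*ˡ m f []       = sym (*-zeroʳ m)
sum-map-*ˡ m f (x ∷ xs) =
  trans (cong (m * f x +_) (sum-map-*ˡ m f xs)) (sym (*-distribˡ-+ m (f x) _))

sum-map-*ʳ : (m : ℕ) (f : A → ℕ) (xs : List A) →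
             sum (map (λ x → f x * m) xs) ≡ sum (map f xs) * m
sum-map-*ʳ m f []       = refl
sum-map-*ʳ m f (x ∷ xs) =
  trans (cong (f x * m +_) (sum-map-*ʳ m f xs)) (sym (*-distribʳ-+ m (f x) _))

sum-map-mono : (f g : A → ℕ) (xs : List A) → (∀ {x} → x ∈ xs → f x ≤ g x) →
               sum (map f xs) ≤ sum (map g xs)
sum-map-mono f g []       f≤g = z≤n
sum-map-mono f g (x ∷ xs) f≤g = +-mono-≤ (f≤g (here refl)) (sum-map-mono f g xs (f≤g ∘ there))

sum-map-cong : (f g : A → ℕ) (xs : List A) → (∀ {x} → x ∈ xs → f x ≡ g x) →
               sum (map f xs) ≡ sum (map g xs)
sum-map-cong f g []       f≡g = refl
sum-map-cong f g (x ∷ xs) f≡g = cong₂ _+_ (f≡g (here refl)) (sum-map-cong f g xs (f≡g ∘ there))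

sum-map-const : (m : ℕ) (xs : List A) → sum (map (λ _ → m) xs) ≡ length xs * m
sum-map-const m []       = refl
sum-map-const m (_ ∷ xs) = cong (m +_) (sum-map-const m xs)

sum-map-zero : (f : A → ℕ) (xs : List A) → (∀ {x} → x ∈ xs → f x ≡ 0) → sum (map f xs) ≡ 0
sum-map-zero f xs f≡0 =
  trans (sum-map-cong f (λ _ → 0) xs f≡0) (trans (sum-map-const 0 xs) (*-zeroʳ (length xs)))

∈⇒≤sum-map : (f : A → ℕ) {xs : List A} {x : A} → x ∈ xs → f x ≤ sum (map f xs)
∈⇒≤sum-map f (here refl) = m≤m+n _ _
∈⇒≤sum-map f {y ∷ _} (there x∈xs) = ≤-trans (∈⇒≤sum-map f x∈xs) (m≤n+m _ (f y))

sum-map-swap : (h : A → B → ℕ) (xs : List A) (ys : List B) →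
               sum (map (λ x → sum (map (h x) ys)) xs) ≡ sum (map (λ y → sum (map (λ x → h x y) xs)) ys)
sum-map-swap h []       ys = sym (sum-map-zero (λ _ → 0) ys (λ _ → refl))
sum-map-swap h (x ∷ xs) ys =
  trans (cong (sum (map (h x) ys) +_) (sum-map-swap h xs ys)) (sym (sum-map-+ (h x) _ ys))

sum-map-drop : (f : A → ℕ) (m : ℕ) (xs : List A) → sum (map f (drop m xs)) ≤ sum (map f xs)
sum-map-drop f zero    xs       = ≤-refl
sum-map-drop f (suc m) []       = z≤n
sum-map-drop f (suc m) (x ∷ xs) = ≤-trans (sum-map-drop f m xs) (m≤n+m _ (f x))

∧-true⇒ˡ : ∀ a b → a ∧ b ≡ true → a ≡ true
∧-true⇒ˡ true _ _ = refl

∧-not-true⇒false : ∀ a b → a ∧ not b ≡ true → b ≡ false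
∧-not-true⇒false true false _  = refl
∧-not-true⇒false true true  ()

sumWhere : (A → Bool) → (A → ℕ) → List A → ℕ
sumWhere p g xs = sum (map (λ x → 𝟙 (p x) * g x) xs)

count : (A → Bool) → List A → ℕ
count p = sumWhere p (λ _ → 1)

sumWhere-mono : (p : A → Bool) (g h : A → ℕ) (xs : List A) → (∀ {x} → x ∈ xs → p x ≡ true → g x ≤ h x) →
                sumWhere p g xs ≤ sumWhere p h xs
sumWhere-mono p g h xs g≤h = sum-map-mono _ _ xs pointwise
  where
  pointwise : ∀ {x} → x ∈ xs → 𝟙 (p x) * g x ≤ 𝟙 (p x) * h x
  pointwise {x} x∈xs with p x in px
  ... | true  = +-monoˡ-≤ 0 (g≤h x∈xs px)
  ... | false = z≤n

sumWhere-cong : (p : A → Bool) (g h : A → ℕ) (xs : List A) → (∀ {x} → x ∈ xs → p x ≡ true → g x ≡ h x) →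
                sumWhere p g xs ≡ sumWhere p h xs
sumWhere-cong p g h xs g≡h = sum-map-cong _ _ xs pointwise
  where
  pointwise : ∀ {x} → x ∈ xs → 𝟙 (p x) * g x ≡ 𝟙 (p x) * h x
  pointwise {x} x∈xs with p x in px
  ... | true  = cong (_+ 0) (g≡h x∈xs px)
  ... | false = refl

sumWhere-⊆ : (p q : A → Bool) (g : A → ℕ) (xs : List A) → (∀ {x} → x ∈ xs → p x ≡ true → q x ≡ true) →
             sumWhere p g xs ≤ sumWhere q g xs
sumWhere-⊆ p q g xs p⊆q = sum-map-mono _ _ xs pointwise
  where
  pointwise : ∀ {x} → x ∈ xs → 𝟙 (p x) * g x ≤ 𝟙 (q x) * g x
  pointwise {x} x∈xs with p x in px
  ... | false = z≤n
  ... | true rewrite p⊆q x∈xs px = ≤-refl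

sumWhere-split : (p q : A → Bool) (g : A → ℕ) (xs : List A) → (∀ {x} → x ∈ xs → q x ≡ true → p x ≡ true) →
                 sumWhere p g xs ≡ sumWhere q g xs + sumWhere (λ x → p x ∧ not (q x)) g xs
sumWhere-split p q g xs q⊆p = trans (sum-map-cong _ _ xs pointwise) (sum-map-+ _ _ xs)
  where
  pointwise : ∀ {x} → x ∈ xs → 𝟙 (p x) * g x ≡ 𝟙 (q x) * g x + 𝟙 (p x ∧ not (q x)) * g x
  pointwise {x} x∈xs with q x in qx
  ... | true rewrite q⊆p x∈xs qx = sym (+-identityʳ _)
  ... | false with p x
  ...   | true  = refl
  ...   | false = refl

sumWhere-const : (p : A → Bool) (m : ℕ) (xs : List A) → sumWhere p (λ _ → m) xs ≡ count p xs * m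
sumWhere-const p m xs = trans (sum-map-cong _ _ xs pointwise) (sum-map-*ʳ m _ xs)
  where
  pointwise : ∀ {x} → x ∈ xs → 𝟙 (p x) * m ≡ 𝟙 (p x) * 1 * m
  pointwise {x} _ = cong (_* m) (sym (*-identityʳ (𝟙 (p x))))

≤-sumWhere : (p : A → Bool) (g : A → ℕ) {xs : List A} {x : A} → x ∈ xs → p x ≡ true → g x ≤ sumWhere p g xs
≤-sumWhere p g {xs} {x} x∈xs px = begin
  g x                 ≡⟨ +-identityʳ (g x) ⟨
  𝟙 true * g x        ≡⟨ cong (λ b → 𝟙 b * g x) px ⟨
  𝟙 (p x) * g x       ≤⟨ ∈⇒≤sum-map (λ y → 𝟙 (p y) * g y) x∈xs ⟩
  sumWhere p g xs     ∎
  where open ≤-Reasoning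

count>0⇒∃ : (p : A → Bool) (xs : List A) → 0 < count p xs → ∃[ x ] x ∈ xs × p x ≡ true
count>0⇒∃ p (x ∷ xs) pos with p x in px
... | true  = x , here refl , px
... | false with count>0⇒∃ p xs pos
...   | y , y∈xs , py = y , there y∈xs , py

∈⇒count>0 : (p : A → Bool) {xs : List A} {x : A} → x ∈ xs → p x ≡ true → 0 < count p xs
∈⇒count>0 p = ≤-sumWhere p (λ _ → 1)

count≤1⇒unique : (p : A → Bool) (xs : List A) → count p xs ≤ 1 →
                 ∀ {x y} → x ∈ xs → y ∈ xs → p x ≡ true → p y ≡ true → x ≡ y
count≤1⇒unique p (z ∷ xs) _ (here refl) (here refl) _ _ = refl
count≤1⇒unique p (z ∷ xs) c≤1 (here refl) (there y∈xs) px py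
  rewrite px = contradiction (≤-pred c≤1) (<⇒≱ (∈⇒count>0 p y∈xs py))
count≤1⇒unique p (z ∷ xs) c≤1 (there x∈xs) (here refl) px py
  rewrite py = contradiction (≤-pred c≤1) (<⇒≱ (∈⇒count>0 p x∈xs px))
count≤1⇒unique p (z ∷ xs) c≤1 (there x∈xs) (there y∈xs) px py =
  count≤1⇒unique p xs (≤-trans (m≤n+m _ (𝟙 (p z) * 1)) c≤1) x∈xs y∈xs px py

length-filter≡count : {P : A → Set} (P? : ∀ x → Dec (P x)) (xs : List A) →
                      length (filter P? xs) ≡ count (does ∘ P?) xs
length-filter≡count P? []       = refl
length-filter≡count P? (x ∷ xs) with does (P? x)
... | true  = cong suc (length-filter≡count P? xs)
... | false = length-filter≡count P? xs

sum-map<length : (f : A → ℕ) (xs : List A) → (∀ {x} → x ∈ xs → f x ≤ 1) →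
                 ∀ {x} → x ∈ xs → f x ≡ 0 → sum (map f xs) < length xs
sum-map<length f (x ∷ xs) f≤1 (here refl) fx≡0 rewrite fx≡0 = s≤s (begin
  sum (map f xs)         ≤⟨ sum-map-mono f (λ _ → 1) xs (f≤1 ∘ there) ⟩
  sum (map (λ _ → 1) xs) ≡⟨ sum-map-const 1 xs ⟩
  length xs * 1          ≡⟨ *-identityʳ (length xs) ⟩
  length xs              ∎)
  where open ≤-Reasoning
sum-map<length f (y ∷ xs) f≤1 (there x∈xs) fx≡0 =
  ≤-trans (≤-reflexive (sym (+-suc (f y) _)))
          (+-mono-≤ (f≤1 (here refl)) (sum-map<length f xs (f≤1 ∘ there) x∈xs fx≡0))

module _ {n : ℕ} where

  open DecMembership (Fin._≟_ {n}) using (_∈?_)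

  count-≟ : (xs : List (Fin n)) → Unique xs → ∀ {x} → x ∈ xs → count (λ y → does (y Fin.≟ x)) xs ≡ 1
  count-≟ (x ∷ xs) (x∉xs ∷ _) (here refl) with x Fin.≟ x
  ... | yes _  = cong suc (sum-map-zero _ xs only-x)
    where
    only-x : ∀ {y} → y ∈ xs → 𝟙 (does (y Fin.≟ x)) * 1 ≡ 0
    only-x {y} y∈xs with y Fin.≟ x
    ... | yes refl = contradiction refl (All.lookup x∉xs y∈xs)
    ... | no _     = refl
  ... | no x≢x = contradiction refl x≢x
  count-≟ (z ∷ xs) (z∉xs ∷ uniq) {x} (there x∈xs) with z Fin.≟ x
  ... | yes refl = contradiction refl (All.lookup z∉xs x∈xs)
  ... | no _     = count-≟ xs uniq x∈xs

  count-∈?-allFin : (xs : List (Fin n)) → Unique xs → count (λ y → does (y ∈? xs)) (allFin n) ≡ length xs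
  count-∈?-allFin []       _              = sum-map-zero _ (allFin n) (λ _ → refl)
  count-∈?-allFin (x ∷ xs) (x∉xs ∷ uniq) = begin
    count (λ y → does (y ∈? x ∷ xs)) (allFin n)
      ≡⟨ sum-map-cong _ _ (allFin n) (λ {y} _ → split y) ⟩
    sum (map (λ y → 𝟙 (does (y Fin.≟ x)) * 1 + 𝟙 (does (y ∈? xs)) * 1) (allFin n))
      ≡⟨ sum-map-+ _ _ (allFin n) ⟩
    count (λ y → does (y Fin.≟ x)) (allFin n) + count (λ y → does (y ∈? xs)) (allFin n)
      ≡⟨ cong₂ _+_ (count-≟ (allFin n) (allFin⁺ n) (∈-allFin x)) (count-∈?-allFin xs uniq) ⟩
    suc (length xs) ∎
    where
    open ≡-Reasoning
    split : ∀ y → 𝟙 (does (y ∈? x ∷ xs)) * 1 ≡ 𝟙 (does (y Fin.≟ x)) * 1 + 𝟙 (does (y ∈? xs)) * 1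
    split y with y Fin.≟ x
    ... | no _ = refl
    ... | yes refl with y ∈? xs
    ...   | no _     = refl
    ...   | yes y∈xs = contradiction refl (All.lookup x∉xs y∈xs)

minL-map-≤ : (f : A → ℕ) {xs : List A} {x : A} → x ∈ xs → minL (map f xs) ≤ f x
minL-map-≤ f {_ ∷ []}    (here refl)     = ≤-refl
minL-map-≤ f {_ ∷ _ ∷ _} (here refl)     = m⊓n≤m _ _
minL-map-≤ f {_ ∷ _ ∷ _} (there x∈xs)    = ≤-trans (m⊓n≤n _ _) (minL-map-≤ f x∈xs)

≤-minL-map : (f : A → ℕ) {m : ℕ} (xs : List A) → xs ≢ [] →
             (∀ {x} → x ∈ xs → m ≤ f x) → m ≤ minL (map f xs)
≤-minL-map f []           []≢[] _   = contradiction refl []≢[]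
≤-minL-map f (x ∷ [])     _     m≤f = m≤f (here refl)
≤-minL-map f (x ∷ y ∷ xs) _     m≤f =
  ⊓-glb (m≤f (here refl)) (≤-minL-map f (y ∷ xs) (λ ()) (m≤f ∘ there))

Unique-++⁻ˡ : (xs : List A) {ys : List A} → Unique (xs ++ ys) → Unique xs
Unique-++⁻ˡ []       _          = []
Unique-++⁻ˡ (x ∷ xs) (x∉ ∷ uniq) = All.++⁻ˡ xs x∉ ∷ Unique-++⁻ˡ xs uniq

Unique-++⁻ʳ : (xs : List A) {ys : List A} → Unique (xs ++ ys) → Unique ys
Unique-++⁻ʳ []       uniq       = uniq
Unique-++⁻ʳ (x ∷ xs) (_ ∷ uniq) = Unique-++⁻ʳ xs uniq

Unique-++⁻-disjoint : (xs : List A) {ys : List A} → Unique (xs ++ ys) → ∀ {z} → z ∈ xs → z ∉ ys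
Unique-++⁻-disjoint (x ∷ xs) (x∉ ∷ _)   (here refl)  z∈ys = All.lookup x∉ (∈-++⁺ʳ xs z∈ys) refl
Unique-++⁻-disjoint (x ∷ xs) (_ ∷ uniq) (there z∈xs)      = Unique-++⁻-disjoint xs uniq z∈xs

Pointwise⇒pairs : {R : A → B → Set} {xs : List A} {ys : List B} → Pointwise R xs ys →
                  ∃[ ps ] map proj₁ ps ≡ xs × map proj₂ ps ≡ ys × All (uncurry R) ps
Pointwise⇒pairs []                          = [] , refl , refl , All.[]
Pointwise⇒pairs (_∷_ {x = x} {y = y} r rs) with Pointwise⇒pairs rs
... | ps , refl , refl , rps = (x , y) ∷ ps , refl , refl , r All.∷ rps

∈leaves-nth : (ts : List (Tree A)) (i : ℕ) {t : Tree A} {y : A} →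
              nth ts i ≡ just t → y ∈ leaves t → y ∈ leavesL ts
∈leaves-nth (t ∷ ts) zero    refl y∈t = ∈-++⁺ˡ y∈t
∈leaves-nth (t ∷ ts) (suc i) ti   y∈t = ∈-++⁺ʳ (leaves t) (∈leaves-nth ts i ti y∈t)

sub-leaf⇒∈leaves : (t : Tree A) (q : Path) {y : A} → sub t q ≡ just (leaf y) → y ∈ leaves t
sub-leaf⇒∈leaves (leaf x)  []      refl = here refl
sub-leaf⇒∈leaves (node ts) (i ∷ q) tq with nth ts i in ti
... | just u = ∈leaves-nth ts i ti (sub-leaf⇒∈leaves u q tq)

mutual
  ∈leaves⇒sub-leaf : (t : Tree A) {y : A} → y ∈ leaves t → ∃[ q ] sub t q ≡ just (leaf y)
  ∈leaves⇒sub-leaf (leaf x)  (here refl) = [] , refl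
  ∈leaves⇒sub-leaf (node ts) y∈ts with ∈leavesL⇒sub-leaf ts y∈ts
  ... | i , q , tsq = i ∷ q , tsq

  ∈leavesL⇒sub-leaf : (ts : List (Tree A)) {y : A} → y ∈ leavesL ts →
                      ∃[ i ] ∃[ q ] (nth ts i >>= λ t → sub t q) ≡ just (leaf y)
  ∈leavesL⇒sub-leaf (t ∷ ts) y∈ts with ∈-++⁻ (leaves t) y∈ts
  ... | inj₁ y∈t  = let q , tq = ∈leaves⇒sub-leaf t y∈t in 0 , q , tq
  ... | inj₂ y∈ts′ = let i , q , tsq = ∈leavesL⇒sub-leaf ts y∈ts′ in suc i , q , tsq

sub-++ : (t : Tree A) (p q : Path) → sub t (p ++ q) ≡ (sub t p >>= λ s → sub s q)
sub-++ t         []      q = refl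
sub-++ (leaf x)  (i ∷ p) q = refl
sub-++ (node ts) (i ∷ p) q with nth ts i
... | just u  = sub-++ u p q
... | nothing = refl

sub-++⁻ : (t : Tree A) (p q : Path) {z : Tree A} → sub t (p ++ q) ≡ just z →
          ∃[ s ] sub t p ≡ just s × sub s q ≡ just z
sub-++⁻ t p q tpq with sub t p | sub-++ t p q
... | just s  | eq = s , refl , trans (sym eq) tpq
... | nothing | eq with trans (sym eq) tpq
...   | ()

sub-leaf-++-∷ : (t : Tree A) (p : Path) {x : A} {i : ℕ} {q : Path} →
                sub t p ≡ just (leaf x) → sub t (p ++ i ∷ q) ≡ nothing
sub-leaf-++-∷ t p {i = i} {q} tp = trans (sub-++ t p (i ∷ q)) (cong (_>>= λ s → sub s (i ∷ q)) tp)

Unique-leaves-nth : (ts : List (Tree A)) (i : ℕ) {t : Tree A} →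
                    Unique (leavesL ts) → nth ts i ≡ just t → Unique (leaves t)
Unique-leaves-nth (t ∷ ts) zero    uniq refl = Unique-++⁻ˡ (leaves t) uniq
Unique-leaves-nth (t ∷ ts) (suc i) uniq ti   = Unique-leaves-nth ts i (Unique-++⁻ʳ (leaves t) uniq) ti

Unique-leaves-sub : (t : Tree A) (p : Path) {s : Tree A} →
                    Unique (leaves t) → sub t p ≡ just s → Unique (leaves s)
Unique-leaves-sub t         []      uniq refl = uniq
Unique-leaves-sub (node ts) (i ∷ p) uniq tp with nth ts i in ti
... | just u = Unique-leaves-sub u p (Unique-leaves-nth ts i uniq ti) tp

nth-index-unique : (ts : List (Tree A)) (i j : ℕ) {t u : Tree A} {y : A} → Unique (leavesL ts) →
                   nth ts i ≡ just t → nth ts j ≡ just u → y ∈ leaves t → y ∈ leaves u → i ≡ j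
nth-index-unique (t ∷ ts) zero    zero    _    _  _  _   _   = refl
nth-index-unique (t ∷ ts) zero    (suc j) uniq refl tj y∈t y∈u =
  contradiction (∈leaves-nth ts j tj y∈u) (Unique-++⁻-disjoint (leaves t) uniq y∈t)
nth-index-unique (t ∷ ts) (suc i) zero    uniq ti refl y∈t y∈u =
  contradiction (∈leaves-nth ts i ti y∈t) (Unique-++⁻-disjoint (leaves t) uniq y∈u)
nth-index-unique (t ∷ ts) (suc i) (suc j) uniq ti tj y∈t y∈u =
  cong suc (nth-index-unique ts i j (Unique-++⁻ʳ (leaves t) uniq) ti tj y∈t y∈u)

sub-leaf-injective : (t : Tree A) (p q : Path) {y : A} → Unique (leaves t) →
                     sub t p ≡ just (leaf y) → sub t q ≡ just (leaf y) → p ≡ q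
sub-leaf-injective (leaf x)  []      []      _    _  _  = refl
sub-leaf-injective (node ts) (i ∷ p) (j ∷ q) uniq tp tq with nth ts i in ti | nth ts j in tj
... | just u | just u′ with nth-index-unique ts i j uniq ti tj (sub-leaf⇒∈leaves u p tp)
                                                            (sub-leaf⇒∈leaves u′ q tq)
...   | refl with trans (sym ti) tj
...     | refl = cong (i ∷_) (sub-leaf-injective u p q (Unique-leaves-nth ts i uniq ti) tp tq)

module _ {n : ℕ} where

  mutual
    locate-sound : (t : Tree (Fin n)) (y : Fin n) {p : Path} → locate t y ≡ just p → sub t p ≡ just (leaf y)
    locate-sound (leaf x)  y ty with y Fin.≟ x
    locate-sound (leaf x)  y refl | yes refl = refl
    locate-sound (node ts) y ty with locateL-sound 0 ts y ty
    ... | j , p′ , refl , tsp = tsp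

    locateL-sound : (i : ℕ) (ts : List (Tree (Fin n))) (y : Fin n) {p : Path} → locateL i ts y ≡ just p →
                    ∃[ j ] ∃[ p′ ] p ≡ i + j ∷ p′ × (nth ts j >>= λ t → sub t p′) ≡ just (leaf y)
    locateL-sound i (t ∷ ts) y tsy with locate t y in ty
    locateL-sound i (t ∷ ts) y refl | just q = 0 , q , cong (_∷ q) (sym (+-identityʳ i)) , locate-sound t y ty
    ... | nothing with locateL-sound (suc i) ts y tsy
    ...   | j , p′ , refl , tsp = suc j , p′ , cong (_∷ p′) (sym (+-suc i j)) , tsp

  mutual
    locate-complete : (t : Tree (Fin n)) {y : Fin n} → y ∈ leaves t → ∃[ p ] locate t y ≡ just p
    locate-complete (leaf x)  {y} (here refl) with y Fin.≟ y
    ... | yes _  = [] , refl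
    ... | no y≢y = contradiction refl y≢y
    locate-complete (node ts) y∈ts = locateL-complete 0 ts y∈ts

    locateL-complete : (i : ℕ) (ts : List (Tree (Fin n))) {y : Fin n} → y ∈ leavesL ts →
                       ∃[ p ] locateL i ts y ≡ just p
    locateL-complete i (t ∷ ts) {y} y∈ts with locate t y in ty
    ... | just q  = i ∷ q , refl
    ... | nothing with ∈-++⁻ (leaves t) y∈ts
    ...   | inj₂ y∈ts′ = locateL-complete (suc i) ts y∈ts′
    ...   | inj₁ y∈t with locate-complete t y∈t
    ...     | q , ty′ with trans (sym ty) ty′
    ...       | ()

-- lcp branches on does (i ≟ j), which normalises to i ≡ᵇ j; case splits on lcp
-- therefore abstract over i ≡ᵇ j, with ≡ᵇ-reflects recovering the equation.
≡ᵇ-reflects : ∀ i j → Reflects (i ≡ j) (i ≡ᵇ j)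
≡ᵇ-reflects i j = proof (i ≟ j)

≡ᵇ-refl : ∀ i → (i ≡ᵇ i) ≡ true
≡ᵇ-refl zero    = refl
≡ᵇ-refl (suc i) = ≡ᵇ-refl i

infix 4.5 _≼ᵇ_

_≼ᵇ_ : Path → Path → Bool
[]      ≼ᵇ _       = true
(_ ∷ _) ≼ᵇ []      = false
(i ∷ v) ≼ᵇ (j ∷ w) = (i ≡ᵇ j) ∧ (v ≼ᵇ w)

≼ᵇ-++ : ∀ v r → v ≼ᵇ v ++ r ≡ true
≼ᵇ-++ []      r = refl
≼ᵇ-++ (i ∷ v) r rewrite ≡ᵇ-refl i = ≼ᵇ-++ v r

≼ᵇ-refl : ∀ v → v ≼ᵇ v ≡ true
≼ᵇ-refl v = subst (λ w → v ≼ᵇ w ≡ true) (++-identityʳ v) (≼ᵇ-++ v [])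

≼ᵇ⇒++ : ∀ v w → v ≼ᵇ w ≡ true → ∃[ r ] w ≡ v ++ r
≼ᵇ⇒++ []      w       _ = w , refl
≼ᵇ⇒++ (i ∷ v) (j ∷ w) v≼w with i ≡ᵇ j | ≡ᵇ-reflects i j
... | true | ofʸ refl = let r , w≡v++r = ≼ᵇ⇒++ v w v≼w in r , cong (i ∷_) w≡v++r

≼ᵇ-trans : ∀ u v w → u ≼ᵇ v ≡ true → v ≼ᵇ w ≡ true → u ≼ᵇ w ≡ true
≼ᵇ-trans u v w u≼v v≼w with ≼ᵇ⇒++ u v u≼v | ≼ᵇ⇒++ v w v≼w
... | r , refl | s , refl rewrite ++-assoc u r s = ≼ᵇ-++ u (r ++ s)

≼ᵇ-comparable : ∀ u v w → u ≼ᵇ w ≡ true → v ≼ᵇ w ≡ true → u ≼ᵇ v ≡ true ⊎ v ≼ᵇ u ≡ true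
≼ᵇ-comparable u v w u≼w v≼w with ≼ᵇ⇒++ u w u≼w | ≼ᵇ⇒++ v w v≼w
... | r , w≡u++r | s , w≡v++s = comparable u v (trans (sym w≡u++r) w≡v++s)
  where
  comparable : ∀ u v {r s} → u ++ r ≡ v ++ s → u ≼ᵇ v ≡ true ⊎ v ≼ᵇ u ≡ true
  comparable []      v       _  = inj₁ refl
  comparable (i ∷ u) []      _  = inj₂ refl
  comparable (i ∷ u) (j ∷ v) eq with ∷-injective eq
  ... | refl , eq′ rewrite ≡ᵇ-refl i = comparable u v eq′

≼ᵇ∧≢⇒⊏ : ∀ v w → v ≼ᵇ w ≡ true → v ≢ w → v ⊏ w
≼ᵇ∧≢⇒⊏ v w v≼w v≢w with ≼ᵇ⇒++ v w v≼w
... | []    , refl = contradiction (sym (++-identityʳ v)) v≢w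
... | i ∷ r , refl = i , r , refl

≼ᵇ∧length≡⇒≡ : ∀ v w → v ≼ᵇ w ≡ true → length v ≡ length w → v ≡ w
≼ᵇ∧length≡⇒≡ v w v≼w |v|≡|w| with ≼ᵇ⇒++ v w v≼w
... | []    , refl = sym (++-identityʳ v)
... | i ∷ r , refl = contradiction (sym (trans |v|≡|w| (length-++ v))) (m+1+n≢m (length v))

≼ᵇ-siblings : ∀ p i c w → p ++ [ i ] ≼ᵇ w ≡ true → p ++ [ c ] ≼ᵇ w ≡ true → i ≡ c
≼ᵇ-siblings p i c w pi≼w pc≼w with ≼ᵇ⇒++ (p ++ [ i ]) w pi≼w | ≼ᵇ⇒++ (p ++ [ c ]) w pc≼w
... | r , refl | s , eq = proj₁ (∷-injective (++-cancelˡ p _ _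
        (trans (sym (++-assoc p [ i ] r)) (trans eq (++-assoc p [ c ] s)))))

≼ᵇ-++-∷ : ∀ p c s → p ++ [ c ] ≼ᵇ p ++ c ∷ s ≡ true
≼ᵇ-++-∷ p c s = subst (λ w → p ++ [ c ] ≼ᵇ w ≡ true) (++-assoc p [ c ] s) (≼ᵇ-++ (p ++ [ c ]) s)

lcp-comm : ∀ a b → lcp a b ≡ lcp b a
lcp-comm []      []      = refl
lcp-comm []      (_ ∷ _) = refl
lcp-comm (_ ∷ _) []      = refl
lcp-comm (i ∷ a) (j ∷ b) with i ≡ᵇ j | ≡ᵇ-reflects i j | j ≡ᵇ i | ≡ᵇ-reflects j i
... | true  | ofʸ refl | true  | _        = cong suc (lcp-comm a b)
... | true  | ofʸ refl | false | ofⁿ i≢i = contradiction refl i≢i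
... | false | ofⁿ i≢j  | true  | ofʸ refl = contradiction refl i≢j
... | false | _        | false | _        = refl

lcp-refl : ∀ a → lcp a a ≡ length a
lcp-refl []      = refl
lcp-refl (i ∷ a) rewrite ≡ᵇ-refl i = cong suc (lcp-refl a)

≼ᵇ⇒≤lcp : ∀ v a b → v ≼ᵇ a ≡ true → v ≼ᵇ b ≡ true → length v ≤ lcp a b
≼ᵇ⇒≤lcp v a b v≼a v≼b with ≼ᵇ⇒++ v a v≼a | ≼ᵇ⇒++ v b v≼b
... | r , refl | s , refl = common v
  where
  common : ∀ v → length v ≤ lcp (v ++ r) (v ++ s)
  common []      = z≤n
  common (i ∷ v) rewrite ≡ᵇ-refl i = s≤s (common v)

⋠ᵇ⇒lcp< : ∀ v a b → v ≼ᵇ b ≡ true → v ≼ᵇ a ≡ false → lcp a b < length v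
⋠ᵇ⇒lcp< v a b v≼b v⋠a with ≼ᵇ⇒++ v b v≼b
... | s , refl = leaves-prefix v a v⋠a
  where
  leaves-prefix : ∀ v a → v ≼ᵇ a ≡ false → lcp a (v ++ s) < length v
  leaves-prefix (i ∷ v) []      _ = s≤s z≤n
  leaves-prefix (i ∷ v) (j ∷ a) v⋠a with j ≡ᵇ i | ≡ᵇ-reflects j i
  ... | false | _ = s≤s z≤n
  ... | true  | ofʸ refl rewrite ≡ᵇ-refl j = s≤s (leaves-prefix v a v⋠a)

lcp-cong-outside : ∀ v a a′ b → v ≼ᵇ a ≡ true → v ≼ᵇ a′ ≡ true → v ≼ᵇ b ≡ false →
                   lcp a b ≡ lcp a′ b
lcp-cong-outside v a a′ b v≼a v≼a′ v⋠b with ≼ᵇ⇒++ v a v≼a | ≼ᵇ⇒++ v a′ v≼a′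
... | r , refl | s , refl = same v b v⋠b
  where
  same : ∀ v b → v ≼ᵇ b ≡ false → lcp (v ++ r) b ≡ lcp (v ++ s) b
  same (i ∷ v) []      _ = refl
  same (i ∷ v) (j ∷ b) v⋠b with i ≡ᵇ j
  ... | true  = cong suc (same v b v⋠b)
  ... | false = refl

Antichain : List Path → Set
Antichain C = ∀ {v w} → v ∈ C → w ∈ C → ¬ v ⊏ w

count-prefixes≤1 : (C : List Path) → Unique C → Antichain C → ∀ b → count (_≼ᵇ b) C ≤ 1
count-prefixes≤1 []      _            _         b = z≤n
count-prefixes≤1 (v ∷ C) (v∉C ∷ uniq) antichain b with v ≼ᵇ b in v≼b
... | false = count-prefixes≤1 C uniq (λ v∈C w∈C → antichain (there v∈C) (there w∈C)) b
... | true  = ≤-reflexive (cong suc (sum-map-zero _ C no-other-prefix))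
  where
  no-other-prefix : ∀ {w} → w ∈ C → 𝟙 (w ≼ᵇ b) * 1 ≡ 0
  no-other-prefix {w} w∈C with w ≼ᵇ b in w≼b
  ... | false = refl
  ... | true with ≼ᵇ-comparable v w b v≼b w≼b
  ...   | inj₁ v≼w = ⊥-elim (antichain (here refl) (there w∈C) (≼ᵇ∧≢⇒⊏ v w v≼w (All.lookup v∉C w∈C)))
  ...   | inj₂ w≼v = ⊥-elim (antichain (there w∈C) (here refl) (≼ᵇ∧≢⇒⊏ w v w≼v (All.lookup v∉C w∈C ∘ sym)))

-- The tree metric of a 2-HST

module HSTProperties (n L k : ℕ) (ρ : Fin n → Fin n → ℚ) (T : Tree (Fin n)) (hst : Is2HST n L ρ T) where

  open HST n L k T
  open Is2HST hst
  open DecMembership (Fin._≟_ {n}) using (_∈?_)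

  U : List (Fin n)
  U = allFin n

  Unique-leaves : Unique (leaves T)
  Unique-leaves = Permutationₛ.Unique-resp-↭ (setoid (Fin n)) (↭⇒↭ₛ (↭-sym leaves-bij)) (allFin⁺ n)

  ∈-leaves : ∀ y → y ∈ leaves T
  ∈-leaves y = ∈-resp-↭ (↭-sym leaves-bij) (∈-allFin y)

  leafPath : Fin n → Path
  leafPath y = proj₁ (locate-complete T (∈-leaves y))

  locate-leafPath : ∀ y → locate T y ≡ just (leafPath y)
  locate-leafPath y = proj₂ (locate-complete T (∈-leaves y))

  sub-leafPath : ∀ y → sub T (leafPath y) ≡ just (leaf y)
  sub-leafPath y = locate-sound T y (locate-leafPath y)

  length-leafPath : ∀ y → length (leafPath y) ≡ L
  length-leafPath y = leaf-level (leafPath y) y (sub-leafPath y)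

  sub-leaf⇒leafPath : ∀ {q y} → sub T q ≡ just (leaf y) → q ≡ leafPath y
  sub-leaf⇒leafPath {q} {y} Tq = sub-leaf-injective T q (leafPath y) Unique-leaves Tq (sub-leafPath y)

  inSubtree : Path → Fin n → Bool
  inSubtree v y = v ≼ᵇ leafPath y

  ∈-cluster⇒inSubtree : ∀ v {y} → y ∈ cluster v → inSubtree v y ≡ true
  ∈-cluster⇒inSubtree v {y} y∈v with sub T v in Tv
  ... | just t with ∈leaves⇒sub-leaf t y∈v
  ...   | q , tq = subst (λ w → v ≼ᵇ w ≡ true) (sub-leaf⇒leafPath Tvq) (≼ᵇ-++ v q)
    where
    Tvq : sub T (v ++ q) ≡ just (leaf y)
    Tvq = trans (sub-++ T v q) (trans (cong (_>>= λ s → sub s q) Tv) tq)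

  inSubtree⇒∈-cluster : ∀ v {y} → inSubtree v y ≡ true → y ∈ cluster v
  inSubtree⇒∈-cluster v {y} v≼y with ≼ᵇ⇒++ v (leafPath y) v≼y
  ... | r , y≡v++r with sub-++⁻ T v r (subst (λ w → sub T w ≡ just (leaf y)) y≡v++r (sub-leafPath y))
  ...   | s , Tv , sr rewrite Tv = sub-leaf⇒∈leaves s r sr

  ∈?-cluster≡inSubtree : ∀ v y → does (y ∈? cluster v) ≡ inSubtree v y
  ∈?-cluster≡inSubtree v y with y ∈? cluster v | inSubtree v y in v≼y
  ... | yes _    | true  = refl
  ... | no _     | false = refl
  ... | yes y∈v  | false = trans (sym (∈-cluster⇒inSubtree v y∈v)) v≼y
  ... | no  y∉v  | true  = contradiction (inSubtree⇒∈-cluster v v≼y) y∉v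

  Unique-cluster : ∀ v → Unique (cluster v)
  Unique-cluster v with sub T v in Tv
  ... | just t  = Unique-leaves-sub T v Unique-leaves Tv
  ... | nothing = []

  count-∈?-cluster : ∀ v xs → count (λ y → does (y ∈? cluster v)) xs ≡ count (inSubtree v) xs
  count-∈?-cluster v xs = sum-map-cong _ _ xs (λ {y} _ → cong (λ b → 𝟙 b * 1) (∈?-cluster≡inSubtree v y))

  N≡count : ∀ v → N v ≡ count (inSubtree v) U
  N≡count v = trans (sym (count-∈?-allFin (cluster v) (Unique-cluster v))) (count-∈?-cluster v U)

  depthDist : ℕ → ℕ
  depthDist d = chainW d L + chainW d L

  depthDist-antitone : ∀ {d d′} → d ≤ d′ → depthDist d′ ≤ depthDist d
  depthDist-antitone {d} d≤d′ with m≤n⇒∃[o]m+o≡n d≤d′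
  ... | o , refl = +-mono-≤ chain≤ chain≤
    where
    chain≤ : chainW (d + o) L ≤ chainW d L
    chain≤ rewrite sym (drop-drop d o (upTo L)) = sum-map-drop edgeW o (drop d (upTo L))

  depthDist-L : depthDist L ≡ 0
  depthDist-L rewrite drop-all L (upTo L) (≤-reflexive (length-upTo L)) = refl

  ρT≡depthDist : ∀ x y → ρT x y ≡ depthDist (lcp (leafPath x) (leafPath y))
  ρT≡depthDist x y rewrite locate-leafPath x | locate-leafPath y | length-leafPath x | length-leafPath y = refl

  ρT-inSubtree-leaf : ∀ x y → inSubtree (leafPath x) y ≡ true → ρT x y ≡ 0
  ρT-inSubtree-leaf x y x≼y
    rewrite ρT≡depthDist x y
          | ≼ᵇ∧length≡⇒≡ (leafPath x) (leafPath y) x≼y (trans (length-leafPath x) (sym (length-leafPath y)))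
          | lcp-refl (leafPath y) | length-leafPath y = depthDist-L

  ρT≤depthDist : ∀ v {x y} → inSubtree v x ≡ true → inSubtree v y ≡ true → ρT x y ≤ depthDist (length v)
  ρT≤depthDist v {x} {y} v≼x v≼y rewrite ρT≡depthDist x y =
    depthDist-antitone (≼ᵇ⇒≤lcp v (leafPath x) (leafPath y) v≼x v≼y)

  depthDist≤ρT : ∀ p c {x y} → inSubtree (p ++ [ c ]) x ≡ true → inSubtree (p ++ [ c ]) y ≡ false →
                 depthDist (length p) ≤ ρT x y
  depthDist≤ρT p c {x} {y} pc≼x pc⋠y rewrite ρT≡depthDist x y | lcp-comm (leafPath x) (leafPath y) =
    depthDist-antitone (≤-pred (subst (lcp (leafPath y) (leafPath x) <_) |pc|≡1+|p|
                                      (⋠ᵇ⇒lcp< (p ++ [ c ]) (leafPath y) (leafPath x) pc≼x pc⋠y)))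
    where
    |pc|≡1+|p| : length (p ++ [ c ]) ≡ suc (length p)
    |pc|≡1+|p| = trans (length-++ p) (+-comm (length p) 1)

  ρT-cong-outside : ∀ v {x x′ y} → inSubtree v x ≡ true → inSubtree v x′ ≡ true → inSubtree v y ≡ false →
                    ρT x y ≡ ρT x′ y
  ρT-cong-outside v {x} {x′} {y} v≼x v≼x′ v⋠y
    rewrite ρT≡depthDist x y | ρT≡depthDist x′ y
          | lcp-cong-outside v (leafPath x) (leafPath x′) (leafPath y) v≼x v≼x′ v⋠y = refl

  ρT-inside≤outside : ∀ v {x y z} → inSubtree v x ≡ true → inSubtree v y ≡ true → inSubtree v z ≡ false →
                      ρT x y ≤ ρT z y
  ρT-inside≤outside v {x} {y} {z} v≼x v≼y v⋠z = begin
    ρT x y                                   ≤⟨ ρT≤depthDist v v≼x v≼y ⟩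
    depthDist (length v)                     ≤⟨ depthDist-antitone (<⇒≤ (⋠ᵇ⇒lcp< v (leafPath z) (leafPath y) v≼y v⋠z)) ⟩
    depthDist (lcp (leafPath z) (leafPath y)) ≡⟨ ρT≡depthDist z y ⟨
    ρT z y                                   ∎
    where open ≤-Reasoning

  subtreeCost : Path → Fin n → ℕ
  subtreeCost v x = sumWhere (inSubtree v) (ρT x) U

  subtreeCost-leafPath : ∀ x → subtreeCost (leafPath x) x ≡ 0
  subtreeCost-leafPath x = begin
    subtreeCost v x                     ≡⟨ sumWhere-cong (inSubtree v) (ρT x) (λ _ → 0) U (λ _ → ρT-inSubtree-leaf x _) ⟩
    sumWhere (inSubtree v) (λ _ → 0) U  ≡⟨ sumWhere-const (inSubtree v) 0 U ⟩
    count (inSubtree v) U * 0           ≡⟨ *-zeroʳ (count (inSubtree v) U) ⟩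
    0                                   ∎
    where
    open ≡-Reasoning
    v : Path
    v = leafPath x

  subtreeCost-via-subtree : ∀ v w {x f} → v ≼ᵇ w ≡ true → inSubtree w x ≡ true → inSubtree w f ≡ true →
                            subtreeCost w x ≤ 2 * subtreeCost w f → subtreeCost v x ≤ 2 * subtreeCost v f
  subtreeCost-via-subtree v w {x} {f} v≼w w≼x w≼f ih = begin
    subtreeCost v x                     ≡⟨ split x ⟩
    subtreeCost w x + outside x         ≤⟨ +-mono-≤ ih (≤-reflexive outside-cong) ⟩
    2 * subtreeCost w f + outside f     ≤⟨ +-monoʳ-≤ _ (m≤n*m (outside f) 2) ⟩
    2 * subtreeCost w f + 2 * outside f ≡⟨ *-distribˡ-+ 2 (subtreeCost w f) (outside f) ⟨
    2 * (subtreeCost w f + outside f)   ≡⟨ cong (2 *_) (split f) ⟨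
    2 * subtreeCost v f                 ∎
    where
    open ≤-Reasoning
    out : Fin n → Bool
    out y = inSubtree v y ∧ not (inSubtree w y)
    outside : Fin n → ℕ
    outside z = sumWhere out (ρT z) U
    split : ∀ z → subtreeCost v z ≡ subtreeCost w z + outside z
    split z = sumWhere-split (inSubtree v) (inSubtree w) (ρT z) U (λ {y} _ → ≼ᵇ-trans v w (leafPath y) v≼w)
    outside-cong : outside x ≡ outside f
    outside-cong = sumWhere-cong out (ρT x) (ρT f) U
                     (λ _ y-out → ρT-cong-outside w w≼x w≼f (∧-not-true⇒false _ _ y-out))

  -- x is within depthDist |p| of every point of T(p), while the points of T(p) outside the
  -- lighter child T(p ++ [ c ]), at least half of T(p), are at least that far from f.
  subtreeCost-lighterSibling : ∀ p i c {x f} → i ≢ c → N (p ++ [ c ]) ≤ N (p ++ [ i ]) →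
                               inSubtree p x ≡ true → inSubtree (p ++ [ c ]) f ≡ true →
                               subtreeCost p x ≤ 2 * subtreeCost p f
  subtreeCost-lighterSibling p i c {x} {f} i≢c lighter p≼x light≼f = begin
    subtreeCost p x                     ≤⟨ sumWhere-mono (inSubtree p) (ρT x) (λ _ → W) U (λ _ → ρT≤depthDist p p≼x) ⟩
    sumWhere (inSubtree p) (λ _ → W) U  ≡⟨ sumWhere-const (inSubtree p) W U ⟩
    count (inSubtree p) U * W           ≤⟨ *-monoˡ-≤ W size≤2*away ⟩
    2 * count away U * W                ≡⟨ *-assoc 2 (count away U) W ⟩
    2 * (count away U * W)              ≡⟨ cong (2 *_) (sumWhere-const away W U) ⟨
    2 * sumWhere away (λ _ → W) U       ≤⟨ *-monoʳ-≤ 2 (sumWhere-mono away (λ _ → W) (ρT f) U W≤ρT) ⟩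
    2 * sumWhere away (ρT f) U          ≤⟨ *-monoʳ-≤ 2 (sumWhere-⊆ away (inSubtree p) (ρT f) U (λ _ → ∧-true⇒ˡ _ _)) ⟩
    2 * subtreeCost p f                 ∎
    where
    open ≤-Reasoning
    heavy light : Path
    heavy = p ++ [ i ]
    light = p ++ [ c ]
    W : ℕ
    W = depthDist (length p)
    away : Fin n → Bool
    away y = inSubtree p y ∧ not (inSubtree light y)
    W≤ρT : ∀ {y} → y ∈ U → away y ≡ true → W ≤ ρT f y
    W≤ρT _ y-away = depthDist≤ρT p c light≼f (∧-not-true⇒false _ _ y-away)
    heavy⊆away : ∀ {y} → y ∈ U → inSubtree heavy y ≡ true → away y ≡ true
    heavy⊆away {y} _ heavy≼y with inSubtree light y in light≼y
    ... | true  = contradiction (≼ᵇ-siblings p i c (leafPath y) heavy≼y light≼y) i≢c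
    ... | false rewrite ≼ᵇ-trans p heavy (leafPath y) (≼ᵇ-++ p [ i ]) heavy≼y = refl
    size≤2*away : count (inSubtree p) U ≤ 2 * count away U
    size≤2*away = begin
      count (inSubtree p) U                  ≡⟨ sumWhere-split (inSubtree p) (inSubtree light) _ U light⊆p ⟩
      count (inSubtree light) U + count away U ≤⟨ +-monoˡ-≤ _ (subst₂ _≤_ (N≡count light) (N≡count heavy) lighter) ⟩
      count (inSubtree heavy) U + count away U ≤⟨ +-monoˡ-≤ _ (sumWhere-⊆ (inSubtree heavy) away _ U heavy⊆away) ⟩
      count away U + count away U            ≡⟨ cong (count away U +_) (+-identityʳ _) ⟨
      2 * count away U                       ∎
      where
      light⊆p : ∀ {y} → y ∈ U → inSubtree light y ≡ true → inSubtree p y ≡ true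
      light⊆p {y} _ = ≼ᵇ-trans p light (leafPath y) (≼ᵇ-++ p [ c ])

  leaf-has-no-child : ∀ {p x i} → sub T p ≡ just (leaf x) → ¬ IsNode (p ++ [ i ])
  leaf-has-no-child {p} Tp (_ , Tpi) with trans (sym Tpi) (sub-leaf-++-∷ T p Tp)
  ... | ()

  descend-≼ᵇ : ∀ {p q} → Descend p q → p ≼ᵇ q ≡ true
  descend-≼ᵇ {p} (stop _)                      = ≼ᵇ-refl p
  descend-≼ᵇ {p} (go {i = i} {q = q} _ _ down) = ≼ᵇ-trans p (p ++ [ i ]) q (≼ᵇ-++ p [ i ]) (descend-≼ᵇ down)

  descend-inSubtree : ∀ {p q x} → Descend p q → sub T q ≡ just (leaf x) → inSubtree p x ≡ true
  descend-inSubtree {p} down Tq = subst (λ w → p ≼ᵇ w ≡ true) (sub-leaf⇒leafPath Tq) (descend-≼ᵇ down)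

  descend-subtreeCost : ∀ {p q x f} → Descend p q → sub T q ≡ just (leaf x) → inSubtree p f ≡ true →
                        subtreeCost p x ≤ 2 * subtreeCost p f
  descend-subtreeCost {p} {x = x} (stop _) Tq _ with sub-leaf⇒leafPath {p} Tq
  ... | refl rewrite subtreeCost-leafPath x = z≤n
  descend-subtreeCost {p} {x = x} {f} (go {i = i} pi-isNode heaviest down) Tq p≼f
    with ≼ᵇ⇒++ p (leafPath f) p≼f
  ... | [] , f≡p = contradiction pi-isNode (leaf-has-no-child {p} Tp)
    where
    Tp : sub T p ≡ just (leaf f)
    Tp = subst (λ w → sub T w ≡ just (leaf f)) (trans f≡p (++-identityʳ p)) (sub-leafPath f)
  ... | c ∷ s , f≡pcs with i ≟ c
  ...   | yes refl = subtreeCost-via-subtree p (p ++ [ i ]) (≼ᵇ-++ p [ i ]) pi≼x pi≼f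
                       (descend-subtreeCost down Tq pi≼f)
    where
    pi≼x : inSubtree (p ++ [ i ]) x ≡ true
    pi≼x = descend-inSubtree down Tq
    pi≼f : inSubtree (p ++ [ i ]) f ≡ true
    pi≼f = subst (λ w → p ++ [ i ] ≼ᵇ w ≡ true) (sym f≡pcs) (≼ᵇ-++-∷ p i s)
  ...   | no i≢c   = subtreeCost-lighterSibling p i c i≢c (heaviest c pc-isNode) p≼x pc≼f
    where
    p≼x : inSubtree p x ≡ true
    p≼x = ≼ᵇ-trans p (p ++ [ i ]) (leafPath x) (≼ᵇ-++ p [ i ]) (descend-inSubtree down Tq)
    pc≼f : inSubtree (p ++ [ c ]) f ≡ true
    pc≼f = subst (λ w → p ++ [ c ] ≼ᵇ w ≡ true) (sym f≡pcs) (≼ᵇ-++-∷ p c s)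
    Tpcs : sub T ((p ++ [ c ]) ++ s) ≡ just (leaf f)
    Tpcs = subst (λ w → sub T w ≡ just (leaf f)) (trans f≡pcs (sym (++-assoc p [ c ] s))) (sub-leafPath f)
    pc-isNode : IsNode (p ++ [ c ])
    pc-isNode = let t , Tpc , _ = sub-++⁻ T (p ++ [ c ]) s Tpcs in t , Tpc

  leafSearch-inSubtree : ∀ {v x} → LeafSearch v x → inSubtree v x ≡ true
  leafSearch-inSubtree (_ , down , Tq) = descend-inSubtree down Tq

  step-antichain : ∀ {C C′} → Step C C′ → Antichain C′
  step-antichain {C} {C′} st v∈C′ w∈C′ = proj₂ (members v∈C′) _ (proj₁ (members w∈C′))
    where
    members : ∀ {v} → v ∈ C′ → v ∈ C ++ Step.S st × (∀ w → w ∈ C ++ Step.S st → ¬ v ⊏ w)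
    members {v} = Equivalence.to (Step.C'-members st v)

  run-invariant : ∀ {C D} → Run C D → Unique C × Antichain C → Unique D × Antichain D × k ≤ length D
  run-invariant (done k≤|C|)     (uniq , antichain) = uniq , antichain , k≤|C|
  run-invariant (step _ st rest) _                 = run-invariant rest (Step.C'-unique st , step-antichain st)

  -- The centres of leaf search against a feasible F

  distTo : List (Fin n) → Fin n → ℕ
  distTo X y = minL (map (λ x → ρT x y) X)

  module CenterCost (ps : List (Path × Fin n)) (uniq : Unique (map proj₁ ps)) (antichain : Antichain (map proj₁ ps))
                    (k≤|C₁| : k ≤ length (map proj₁ ps)) (searched : All (uncurry LeafSearch) ps)
                    (1≤k : 1 ≤ k) (F : List (Fin n)) (feasible : Feasible (map proj₁ ps) F) where

    covers : Path × Fin n → Fin n → Bool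
    covers vx = inSubtree (proj₁ vx)

    coverCount : Fin n → ℕ
    coverCount y = count (λ vx → covers vx y) ps

    coverCount≤1 : ∀ y → coverCount y ≤ 1
    coverCount≤1 y = subst (_≤ 1) (sym (cong sum (map-∘ {g = λ v → 𝟙 (v ≼ᵇ leafPath y) * 1} {f = proj₁} ps)))
                           (count-prefixes≤1 (map proj₁ ps) uniq antichain (leafPath y))

    count-F≡1 : ∀ {vx} → vx ∈ ps → count (covers vx) F ≡ 1
    count-F≡1 {v , _} vx∈ps = begin
      count (inSubtree v) F                  ≡⟨ count-∈?-cluster v F ⟨
      count (λ y → does (y ∈? cluster v)) F  ≡⟨ length-filter≡count (_∈? cluster v) F ⟨
      length (filter (_∈? cluster v) F)      ≡⟨ proj₂ (proj₂ feasible) v (∈-map⁺ proj₁ vx∈ps) ⟩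
      1                                      ∎
      where open ≡-Reasoning

    F≢[] : F ≢ []
    F≢[] F≡[] = m<n⇒n≢0 1≤k (trans (sym (proj₁ (proj₂ feasible))) (cong length F≡[]))

    Σ-coverCount : sum (map coverCount F) ≡ length ps
    Σ-coverCount = begin
      sum (map coverCount F)                  ≡⟨ sum-map-swap (λ vx y → 𝟙 (covers vx y) * 1) ps F ⟨
      sum (map (λ vx → count (covers vx) F) ps) ≡⟨ sum-map-cong _ _ ps count-F≡1 ⟩
      sum (map (λ _ → 1) ps)                  ≡⟨ sum-map-const 1 ps ⟩
      length ps * 1                           ≡⟨ *-identityʳ (length ps) ⟩
      length ps                               ∎
      where open ≡-Reasoning

    -- The subtrees T(v) are disjoint and each contains exactly one point of F, while |F| = k ≤ |C₁|.
    F-covered : ∀ {f} → f ∈ F → ∃[ vx ] vx ∈ ps × covers vx f ≡ true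
    F-covered {f} f∈F with coverCount f in cf
    ... | suc _ = count>0⇒∃ (λ vx → covers vx f) ps (subst (0 <_) (sym cf) (s≤s z≤n))
    ... | zero  = contradiction (sum-map<length coverCount F (λ {y} _ → coverCount≤1 y) f∈F cf) (≤⇒≯ |F|≤Σ)
      where
      |F|≤Σ : length F ≤ sum (map coverCount F)
      |F|≤Σ = begin
        length F               ≡⟨ proj₁ (proj₂ feasible) ⟩
        k                      ≤⟨ k≤|C₁| ⟩
        length (map proj₁ ps)  ≡⟨ length-map proj₁ ps ⟩
        length ps              ≡⟨ Σ-coverCount ⟨
        sum (map coverCount F) ∎
        where open ≤-Reasoning

    nearCost : Fin n → ℕ
    nearCost y = sumWhere (λ vx → covers vx y) (λ vx → ρT (proj₂ vx) y) ps

    -- A point in some T(v) is served by the centre chosen in T(v).  A point y in none of them is,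
    -- for every f ∈ F, as far from the centre of the subtree containing f as from f itself.
    distTo-centers≤ : ∀ y → distTo (map proj₂ ps) y ≤ nearCost y + (1 ∸ coverCount y) * distTo F y
    distTo-centers≤ y with coverCount y in cy
    ... | suc _ with count>0⇒∃ (λ vx → covers vx y) ps (subst (0 <_) (sym cy) (s≤s z≤n))
    ...   | (v , x) , vx∈ps , v≼y = begin
      distTo (map proj₂ ps) y  ≤⟨ minL-map-≤ (λ x → ρT x y) (∈-map⁺ proj₂ vx∈ps) ⟩
      ρT x y                   ≤⟨ ≤-sumWhere (λ vx → covers vx y) (λ vx → ρT (proj₂ vx) y) vx∈ps v≼y ⟩
      nearCost y               ≤⟨ m≤m+n (nearCost y) _ ⟩
      nearCost y + _           ∎
      where open ≤-Reasoning
    distTo-centers≤ y | zero = begin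
      distTo (map proj₂ ps) y      ≤⟨ ≤-minL-map (λ f → ρT f y) F F≢[] center≤ ⟩
      distTo F y                   ≡⟨ +-identityʳ (distTo F y) ⟨
      1 * distTo F y               ≤⟨ m≤n+m _ (nearCost y) ⟩
      nearCost y + 1 * distTo F y  ∎
      where
      open ≤-Reasoning
      center≤ : ∀ {f} → f ∈ F → distTo (map proj₂ ps) y ≤ ρT f y
      center≤ {f} f∈F with F-covered f∈F
      ... | (v , x) , vx∈ps , v≼f = begin
        distTo (map proj₂ ps) y ≤⟨ minL-map-≤ (λ x → ρT x y) (∈-map⁺ proj₂ vx∈ps) ⟩
        ρT x y                  ≡⟨ ρT-cong-outside v (leafSearch-inSubtree (All.lookup searched vx∈ps)) v≼f y-outside ⟩
        ρT f y                  ∎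
        where
        y-outside : inSubtree v y ≡ false
        y-outside with inSubtree v y in v≼y
        ... | false = refl
        ... | true  = contradiction (subst (0 <_) cy (∈⇒count>0 (λ vx → covers vx y) vx∈ps v≼y)) (λ ())

    subtreeCost-center≤2*distTo : ∀ {vx} → vx ∈ ps →
                                  subtreeCost (proj₁ vx) (proj₂ vx) ≤ 2 * sumWhere (covers vx) (distTo F) U
    subtreeCost-center≤2*distTo {v , x} vx∈ps
      with All.lookup searched vx∈ps | count>0⇒∃ (inSubtree v) F (≤-reflexive (sym (count-F≡1 vx∈ps)))
    ... | _ , down , Tq | fv , fv∈F , v≼fv =
      ≤-trans (descend-subtreeCost down Tq v≼fv) (*-monoʳ-≤ 2 (sumWhere-mono (inSubtree v) (ρT fv) (distTo F) U fv-nearest))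
      where
      fv-nearest : ∀ {y} → y ∈ U → inSubtree v y ≡ true → ρT fv y ≤ distTo F y
      fv-nearest {y} _ v≼y = ≤-minL-map (λ f → ρT f y) F F≢[] fv≤
        where
        fv≤ : ∀ {f} → f ∈ F → ρT fv y ≤ ρT f y
        fv≤ {f} f∈F with inSubtree v f in v≼f
        ... | true  rewrite count≤1⇒unique (inSubtree v) F (≤-reflexive (count-F≡1 vx∈ps)) f∈F fv∈F v≼f v≼fv = ≤-refl
        ... | false = ρT-inside≤outside v v≼fv v≼y v≼f

    Σ-covers-swap : (g : Path × Fin n → Fin n → ℕ) →
                    sum (map (λ y → sumWhere (λ vx → covers vx y) (λ vx → g vx y) ps) U)
                    ≡ sum (map (λ vx → sumWhere (covers vx) (g vx) U) ps)
    Σ-covers-swap g = sym (sum-map-swap (λ vx y → 𝟙 (covers vx y) * g vx y) ps U)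

    Σ-nearCost≤ : sum (map nearCost U) ≤ 2 * sum (map (λ y → coverCount y * distTo F y) U)
    Σ-nearCost≤ = begin
      sum (map nearCost U)
        ≡⟨ Σ-covers-swap (λ vx y → ρT (proj₂ vx) y) ⟩
      sum (map (λ vx → subtreeCost (proj₁ vx) (proj₂ vx)) ps)
        ≤⟨ sum-map-mono _ _ ps subtreeCost-center≤2*distTo ⟩
      sum (map (λ vx → 2 * sumWhere (covers vx) (distTo F) U) ps)
        ≡⟨ sum-map-*ˡ 2 _ ps ⟩
      2 * sum (map (λ vx → sumWhere (covers vx) (distTo F) U) ps)
        ≡⟨ cong (2 *_) (Σ-covers-swap (λ _ y → distTo F y)) ⟨
      2 * sum (map (λ y → sumWhere (λ vx → covers vx y) (λ _ → distTo F y) ps) U)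
        ≡⟨ cong (2 *_) (sum-map-cong _ _ U (λ {y} _ → sumWhere-const (λ vx → covers vx y) (distTo F y) ps)) ⟩
      2 * sum (map (λ y → coverCount y * distTo F y) U) ∎
      where open ≤-Reasoning

    costF-centers≤2*costF : costF (map proj₂ ps) ≤ 2 * costF F
    costF-centers≤2*costF = begin
      costF (map proj₂ ps)                    ≤⟨ sum-map-mono _ _ U (λ {y} _ → distTo-centers≤ y) ⟩
      sum (map (λ y → nearCost y + far y) U)  ≡⟨ sum-map-+ nearCost far U ⟩
      sum (map nearCost U) + Σfar             ≤⟨ +-mono-≤ Σ-nearCost≤ (m≤n*m Σfar 2) ⟩
      2 * Σcovered + 2 * Σfar                 ≡⟨ *-distribˡ-+ 2 Σcovered Σfar ⟨
      2 * (Σcovered + Σfar)                   ≡⟨ cong (2 *_) (sum-map-+ _ far U) ⟨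
      2 * sum (map (λ y → coverCount y * distTo F y + far y) U)
        ≡⟨ cong (2 *_) (sum-map-cong _ _ U (λ {y} _ → m*n+[1∸m]*n≡n (distTo F y) (coverCount≤1 y))) ⟩
      2 * costF F                             ∎
      where
      open ≤-Reasoning
      far : Fin n → ℕ
      far y = (1 ∸ coverCount y) * distTo F y
      Σfar Σcovered : ℕ
      Σfar     = sum (map far U)
      Σcovered = sum (map (λ y → coverCount y * distTo F y) U)

open HSTProperties using (module CenterCost; run-invariant)

mainTheorem2 : (n L k : ℕ) (ρ : Fin n → Fin n → ℚ) → MetricSpaceData n L ρ →
               (T : Tree (Fin n)) → Is2HST n L ρ T →
               1 ≤ k → k ≤ n →
               (C₁ : List Path) → HST.Run n L k T [] C₁ →
               (C₀ : List (Fin n)) → Pointwise (HST.LeafSearch n L k T) C₁ C₀ →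
               (c : ℕ) → HST.IsCost' n L k T C₁ c →
               HST.costF n L k T C₀ ≤ 2 * c
mainTheorem2 n L k ρ _ T hst 1≤k _ C₁ run C₀ leafSearches c ((F , feasible , refl) , _)
  with Pointwise⇒pairs leafSearches
... | ps , refl , refl , searched with run-invariant n L k ρ T hst run ([] , λ ())
...   | uniq , antichain , k≤|C₁| =
  CenterCost.costF-centers≤2*costF n L k ρ T hst ps uniq antichain k≤|C₁| searched 1≤k F feasible
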